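{- Let $p$ and $q$ be distinct odd primes with $q<p$. Then the number $N_{p,q}$ of solutions $(x,y,z)$ in non-negative integers of $px+qy+z=\frac{q(p-1)}{2}$ is $$N_{p,q}=\frac{p+1}{2}+\frac{(p-1)(q-1)}{4}-\sum_{i=1}^{\frac{q-1}{2}}\Big\lfloor\frac{ip}{q}\Big\rfloor.$$
   Context: $\lfloor t\rfloor$ denotes the greatest integer less than or equal to $t$. -}

module Defs where

open import Data.Nat using (ℕ; zero; suc; _+_; _*_; _∸_; _/_)
open import Data.Product using (Σ; _×_)
open import Relation.Binary.PropositionalEquality using (_≡_)

Solutions : ℕ → ℕ → ℕ → Set
Solutions p q n = Σ ℕ λ x → Σ ℕ λ y → Σ ℕ λ z → p * x + q * y + z ≡ n

floorSum : (p q : ℕ) → .{{_ : Data.Nat.NonZero q}} → ℕ → ℕ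
floorSum p q zero = 0
floorSum p q (suc m) = floorSum p q m + (suc m * p) / q

{-# OPTIONS --safe #-}
module Submission where

-- Write p = 2a + 1 and q = 2m + 1, so that the right-hand side is q a.  Counting the
-- solutions by x, for each of the m + 1 admissible values x = 0, …, m (note m = ⌊q a / p⌋)
-- there are ⌊(q a − p x) / q⌋ + 1 of them.  For 1 ≤ x ≤ m, q does not divide x p since q
-- is a prime different from p and x < q; hence ⌊(q a − p x) / q⌋ + 1 = a − ⌊x p / q⌋, and
-- summing gives (a + 1) + a m − Σ_{x=1}^{m} ⌊x p / q⌋.

open import Data.Nat
open import Data.Nat.Properties
open import Data.Nat.DivMod
open import Data.Nat.Divisibility using (_∤_; divides; >⇒∤; m%n≡0⇒n∣m)
open import Data.Nat.Primality using (Prime; euclidsLemma; prime⇒irreducible; ¬prime[1])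
open import Data.Nat.Solver using (module +-*-Solver)
open import Data.Integer using (+_; _-_)
open import Data.Integer.Properties using (pos-+; +-0-abelianGroup)
open import Algebra.Properties.CommutativeSemigroup +-commutativeSemigroup
  using () renaming (interchange to +-interchange)
open import Algebra.Properties.AbelianGroup +-0-abelianGroup using (//-rightDividesʳ)
open import Data.Fin using (Fin; zero)
open import Data.Fin.Properties using (+↔⊎)
open import Data.Product using (Σ; ∃; _×_; _,_)
open import Data.Product.Properties using (Σ-≡,≡→≡)
open import Data.Sum using (_⊎_; inj₁; inj₂; [_,_]′)
open import Data.Sum.Function.Propositional using (_⊎-↔_)
open import Data.Empty using (⊥-elim)
open import Function using (_∘_)
open import Function.Bundles using (_↔_; mk↔ₛ′)
open import Function.Properties.Inverse using (↔-trans; ↔-sym)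
open import Relation.Nullary using (¬_)
open import Relation.Binary.PropositionalEquality
open import Defs

open +-*-Solver

sumBelow : (ℕ → ℕ) → ℕ → ℕ
sumBelow c zero    = 0
sumBelow c (suc n) = c 0 + sumBelow (c ∘ suc) n

sumBelow-suc : ∀ c n → sumBelow c (suc n) ≡ sumBelow c n + c n
sumBelow-suc c zero    = +-comm (c 0) 0
sumBelow-suc c (suc n) = begin
  c 0 + sumBelow (c ∘ suc) (suc n)         ≡⟨ cong (λ s → c 0 + s) (sumBelow-suc (c ∘ suc) n) ⟩
  c 0 + (sumBelow (c ∘ suc) n + c (suc n))  ≡⟨ +-assoc (c 0) _ _ ⟨
  sumBelow c (suc n) + c (suc n)            ∎
  where open ≡-Reasoning

sumBelow-ones : ∀ n → sumBelow (λ _ → 1) n ≡ n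
sumBelow-ones zero    = refl
sumBelow-ones (suc n) = cong suc (sumBelow-ones n)

Σℕ↔⊎ : {T : ℕ → Set} → Σ ℕ T ↔ (T 0 ⊎ Σ ℕ (T ∘ suc))
Σℕ↔⊎ {T} = mk↔ₛ′ to from to∘from from∘to
  where
  to : Σ ℕ T → T 0 ⊎ Σ ℕ (T ∘ suc)
  to (zero  , t) = inj₁ t
  to (suc x , t) = inj₂ (x , t)
  from : T 0 ⊎ Σ ℕ (T ∘ suc) → Σ ℕ T
  from (inj₁ t)       = 0 , t
  from (inj₂ (x , t)) = suc x , t
  to∘from : ∀ w → to (from w) ≡ w
  to∘from (inj₁ t)       = refl
  to∘from (inj₂ (x , t)) = refl
  from∘to : ∀ w → from (to w) ≡ w
  from∘to (zero  , t) = refl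
  from∘to (suc x , t) = refl

Σℕ↔Fin0 : {T : ℕ → Set} → (∀ x → ¬ T x) → Σ ℕ T ↔ Fin 0
Σℕ↔Fin0 empty = mk↔ₛ′ (λ { (x , t) → ⊥-elim (empty x t) }) (λ ()) (λ ())
                      (λ { (x , t) → ⊥-elim (empty x t) })

Σℕ↔Fin-sumBelow : ∀ n {T : ℕ → Set} (c : ℕ → ℕ) →
  (∀ x → x < n → T x ↔ Fin (c x)) → (∀ x → n ≤ x → ¬ T x) →
  Σ ℕ T ↔ Fin (sumBelow c n)
Σℕ↔Fin-sumBelow zero    c count empty = Σℕ↔Fin0 (λ x → empty x z≤n)
Σℕ↔Fin-sumBelow (suc n) {T} c count empty =
  ↔-trans Σℕ↔⊎ (↔-trans (count 0 z<s ⊎-↔ rest) (↔-sym +↔⊎))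
  where
  rest : Σ ℕ (T ∘ suc) ↔ Fin (sumBelow (c ∘ suc) n)
  rest = Σℕ↔Fin-sumBelow n (c ∘ suc) (λ x x<n → count (suc x) (s<s x<n))
                                      (λ x n≤x → empty (suc x) (s≤s n≤x))

m≤o/n⇒n*m≤o : ∀ {m} n {o} .{{_ : NonZero n}} → m ≤ o / n → n * m ≤ o
m≤o/n⇒n*m≤o {m} n {o} m≤o/n = begin
  n * m      ≡⟨ *-comm n m ⟩
  m * n      ≤⟨ *-monoˡ-≤ n m≤o/n ⟩
  o / n * n  ≤⟨ m/n*n≤m o n ⟩
  o          ∎
  where open ≤-Reasoning

o/n<m⇒o<n*m : ∀ {m} n {o} .{{_ : NonZero n}} → o / n < m → o < n * m
o/n<m⇒o<n*m {m} n {o} o/n<m = ≰⇒> λ n*m≤o →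
  <⇒≱ o/n<m (subst (_≤ o / n) n*m/n≡m (/-monoˡ-≤ n n*m≤o))
  where
  n*m/n≡m : n * m / n ≡ m
  n*m/n≡m = trans (/-congˡ (*-comm n m)) (m*n/n≡m m n)

Σ-multiple↔Fin : ∀ a t {G : ℕ → Set} (c : ℕ → ℕ) .{{_ : NonZero a}} →
  (∀ k → k ≤ t → G k ↔ Fin (c k)) → (∀ k → t < k → ¬ G k) →
  Σ ℕ (λ x → G (a * x)) ↔ Fin (sumBelow (λ x → c (a * x)) (suc (t / a)))
Σ-multiple↔Fin a t c count empty = Σℕ↔Fin-sumBelow (suc (t / a)) (λ x → c (a * x))
  (λ x x≤t/a → count (a * x) (m≤o/n⇒n*m≤o a (s≤s⁻¹ x≤t/a)))
  (λ x t/a<x → empty (a * x) (o/n<m⇒o<n*m a t/a<x))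

∃[o]m+o≡n↔Fin1 : ∀ {m n} → m ≤ n → (∃ λ o → m + o ≡ n) ↔ Fin 1
∃[o]m+o≡n↔Fin1 {m} {n} m≤n = mk↔ₛ′ (λ _ → zero) (λ _ → witness) (λ { zero → refl }) unique
  where
  witness : ∃ λ o → m + o ≡ n
  witness = n ∸ m , m+[n∸m]≡n m≤n
  unique : ∀ w → witness ≡ w
  unique (o , refl) = Σ-≡,≡→≡ (m+n∸m≡n m o , ≡-irrelevant _ _)

n<m⇒∄[o]m+o≡n : ∀ {m n} → n < m → ¬ (∃ λ o → m + o ≡ n)
n<m⇒∄[o]m+o≡n {m} n<m (o , m+o≡n) = <⇒≱ n<m (subst (m ≤_) m+o≡n (m≤m+n m o))

shifted-solutions₂↔Fin : ∀ q {k n} .{{_ : NonZero q}} → k ≤ n →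
  (Σ ℕ λ y → Σ ℕ λ z → k + q * y + z ≡ n) ↔ Fin (suc ((n ∸ k) / q))
shifted-solutions₂↔Fin q {k} {n} k≤n =
  subst (λ s → (Σ ℕ λ y → Σ ℕ λ z → k + q * y + z ≡ n) ↔ Fin s)
        (sumBelow-ones (suc ((n ∸ k) / q)))
        (Σ-multiple↔Fin q (n ∸ k) (λ _ → 1) one none)
  where
  one : ∀ j → j ≤ n ∸ k → (∃ λ z → k + j + z ≡ n) ↔ Fin 1
  one j j≤n∸k = ∃[o]m+o≡n↔Fin1 (subst (k + j ≤_) (m+[n∸m]≡n k≤n) (+-monoʳ-≤ k j≤n∸k))
  none : ∀ j → n ∸ k < j → ¬ (∃ λ z → k + j + z ≡ n)
  none j n∸k<j = n<m⇒∄[o]m+o≡n (subst (_< k + j) (m+[n∸m]≡n k≤n) (+-monoʳ-< k n∸k<j))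

Solutions↔Fin : ∀ p q n .{{_ : NonZero p}} .{{_ : NonZero q}} →
  Solutions p q n ↔ Fin (sumBelow (λ x → suc ((n ∸ p * x) / q)) (suc (n / p)))
Solutions↔Fin p q n = Σ-multiple↔Fin p n (λ k → suc ((n ∸ k) / q))
  (λ k → shifted-solutions₂↔Fin q)
  (λ k n<k (y , z , e) → n<m⇒∄[o]m+o≡n n<k (q * y + z , trans (sym (+-assoc k (q * y) z)) e))

∤⇒0<% : ∀ q v .{{_ : NonZero q}} → q ∤ v → 0 < v % q
∤⇒0<% q v q∤v = n≢0⇒n>0 (q∤v ∘ m%n≡0⇒n∣m v q)

∤∧≤*⇒/< : ∀ q a v .{{_ : NonZero q}} → q ∤ v → v ≤ q * a → v / q < a
∤∧≤*⇒/< q a v q∤v v≤qa = *-cancelʳ-< q (v / q) a (begin-strict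
  v / q * q          <⟨ +-monoˡ-< (v / q * q) (∤⇒0<% q v q∤v) ⟩
  v % q + v / q * q  ≡⟨ m≡m%n+[m/n]*n v q ⟨
  v                  ≤⟨ v≤qa ⟩
  q * a              ≡⟨ *-comm q a ⟩
  a * q              ∎)
  where open ≤-Reasoning

q*a∸v/q+1+v/q≡a : ∀ q a v .{{_ : NonZero q}} → v ≤ q * a → q ∤ v →
  suc ((q * a ∸ v) / q) + v / q ≡ a
q*a∸v/q+1+v/q≡a q a v v≤qa q∤v = begin
  suc ((q * a ∸ v) / q) + k  ≡⟨ cong (λ s → suc s + k) [qa∸v]/q≡j ⟩
  suc j + k                  ≡⟨ cong suc (+-comm j k) ⟩
  suc k + j                  ≡⟨ m+[n∸m]≡n k<a ⟩
  a                          ∎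
  where
  open ≡-Reasoning
  k r : ℕ
  k = v / q
  r = v % q
  k<a : k < a
  k<a = ∤∧≤*⇒/< q a v q∤v v≤qa
  j : ℕ
  j = a ∸ suc k
  -- Since 0 < r, the remainder of q a − v modulo q is q − r rather than 0.
  qa∸v≡[q∸r]+jq : q * a ∸ v ≡ (q ∸ r) + j * q
  qa∸v≡[q∸r]+jq = begin
    q * a ∸ v                          ≡⟨ cong (λ b → q * b ∸ v) (m+[n∸m]≡n k<a) ⟨
    q * (suc k + j) ∸ v                ≡⟨ cong (_∸ v) (expand q k j) ⟩
    q + (j * q + k * q) ∸ v            ≡⟨ cong (λ s → s + (j * q + k * q) ∸ v) (m∸n+n≡m (m%n≤n v q)) ⟨
    (q ∸ r + r) + (j * q + k * q) ∸ v  ≡⟨ cong (λ s → s ∸ v) (shuffle (q ∸ r) j q r k) ⟩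
    (q ∸ r) + j * q + (r + k * q) ∸ v  ≡⟨ cong (λ s → (q ∸ r) + j * q + s ∸ v) (m≡m%n+[m/n]*n v q) ⟨
    (q ∸ r) + j * q + v ∸ v            ≡⟨ m+n∸n≡m _ v ⟩
    (q ∸ r) + j * q                    ∎
    where
    expand : ∀ q k j → q * (suc k + j) ≡ q + (j * q + k * q)
    expand = solve 3 (λ q k j → q :* (con 1 :+ k :+ j) := q :+ (j :* q :+ k :* q)) refl
    shuffle : ∀ s j q r k → (s + r) + (j * q + k * q) ≡ s + j * q + (r + k * q)
    shuffle = solve 5 (λ s j q r k → (s :+ r) :+ (j :* q :+ k :* q) := s :+ j :* q :+ (r :+ k :* q)) refl
  [qa∸v]/q≡j : (q * a ∸ v) / q ≡ j
  [qa∸v]/q≡j = begin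
    (q * a ∸ v) / q          ≡⟨ /-congˡ qa∸v≡[q∸r]+jq ⟩
    ((q ∸ r) + j * q) / q    ≡⟨ +-distrib-/-∣ʳ (q ∸ r) (divides j refl) ⟩
    (q ∸ r) / q + j * q / q  ≡⟨ cong₂ _+_ (m<n⇒m/n≡0 (∸-monoʳ-< (∤⇒0<% q v q∤v) (m%n≤n v q))) (m*n/n≡m j q) ⟩
    j                        ∎

sumBelow-fibres+floorSum : ∀ p q a m .{{_ : NonZero q}} → p * m ≤ q * a →
  (∀ x → 0 < x → x ≤ m → q ∤ x * p) →
  sumBelow (λ x → suc ((q * a ∸ p * x) / q)) (suc m) + floorSum p q m ≡ suc a + a * m
sumBelow-fibres+floorSum p q a m pm≤qa q∤xp = begin
  c 0 + sumBelow (c ∘ suc) m + floorSum p q m    ≡⟨ +-assoc (c 0) _ _ ⟩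
  c 0 + (sumBelow (c ∘ suc) m + floorSum p q m)  ≡⟨ cong₂ _+_ c0≡1+a (partial m ≤-refl) ⟩
  suc a + m * a                                  ≡⟨ cong (λ t → suc a + t) (*-comm m a) ⟩
  suc a + a * m                                  ∎
  where
  open ≡-Reasoning
  c : ℕ → ℕ
  c x = suc ((q * a ∸ p * x) / q)
  c0≡1+a : c 0 ≡ suc a
  c0≡1+a = cong suc (begin
    (q * a ∸ p * 0) / q  ≡⟨ cong (λ t → (q * a ∸ t) / q) (*-zeroʳ p) ⟩
    q * a / q            ≡⟨ /-congˡ (*-comm q a) ⟩
    a * q / q            ≡⟨ m*n/n≡m a q ⟩
    a                    ∎)
  column : ∀ x → 0 < x → x ≤ m → c x + x * p / q ≡ a
  column x 0<x x≤m = begin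
    c x + x * p / q                        ≡⟨ cong (λ t → suc ((q * a ∸ t) / q) + x * p / q) (*-comm p x) ⟩
    suc ((q * a ∸ x * p) / q) + x * p / q  ≡⟨ q*a∸v/q+1+v/q≡a q a (x * p) xp≤qa (q∤xp x 0<x x≤m) ⟩
    a                                      ∎
    where
    xp≤qa : x * p ≤ q * a
    xp≤qa = ≤-trans (≤-reflexive (*-comm x p)) (≤-trans (*-monoʳ-≤ p x≤m) pm≤qa)
  partial : ∀ k → k ≤ m → sumBelow (c ∘ suc) k + floorSum p q k ≡ k * a
  partial zero    _   = refl
  partial (suc k) k<m = begin
    sumBelow (c ∘ suc) (suc k) + (floorSum p q k + suc k * p / q)
      ≡⟨ cong (_+ (floorSum p q k + suc k * p / q)) (sumBelow-suc (c ∘ suc) k) ⟩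
    (sumBelow (c ∘ suc) k + c (suc k)) + (floorSum p q k + suc k * p / q)
      ≡⟨ +-interchange (sumBelow (c ∘ suc) k) _ _ _ ⟩
    (sumBelow (c ∘ suc) k + floorSum p q k) + (c (suc k) + suc k * p / q)
      ≡⟨ cong₂ _+_ (partial k (<⇒≤ k<m)) (column (suc k) z<s k<m) ⟩
    k * a + a
      ≡⟨ +-comm (k * a) a ⟩
    suc k * a ∎

m+n≡o+p⇒+m≡+o++p-+n : ∀ {m n o p} → m + n ≡ o + p → + m ≡ (+ o Data.Integer.+ + p) - + n
m+n≡o+p⇒+m≡+o++p-+n {m} {n} {o} {p} m+n≡o+p = begin
  + m                          ≡⟨ //-rightDividesʳ (+ n) (+ m) ⟨
  (+ m Data.Integer.+ + n) - + n  ≡⟨ cong (_- + n) (pos-+ m n) ⟨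
  + (m + n) - + n              ≡⟨ cong (λ t → + t - + n) m+n≡o+p ⟩
  + (o + p) - + n              ≡⟨ cong (_- + n) (pos-+ o p) ⟩
  (+ o Data.Integer.+ + p) - + n  ∎
  where open ≡-Reasoning

solutionCount-odd : ∀ p q a m .{{_ : NonZero q}} → p ≡ suc (a * 2) → q ≡ suc (m * 2) → m < a →
  (∀ x → 0 < x → x ≤ m → q ∤ x * p) →
  Σ ℕ λ N → (Solutions p q ((q * (p ∸ 1)) / 2) ↔ Fin N)
    × (+ N ≡ (+ ((p + 1) / 2) Data.Integer.+ + (((p ∸ 1) * (q ∸ 1)) / 4)) - + floorSum p q ((q ∸ 1) / 2))
solutionCount-odd .(suc (a * 2)) .(suc (m * 2)) a m refl refl m<a q∤xp =
  N , subst (λ n → Solutions p q n ↔ Fin N) (sym half[q*[p∸1]]) solutions , ℤ-count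
  where
  p q : ℕ
  p = suc (a * 2)
  q = suc (m * 2)
  N : ℕ
  N = sumBelow (λ x → suc ((q * a ∸ p * x) / q)) (suc m)
  qa≡[a∸m]+mp : q * a ≡ (a ∸ m) + m * p
  qa≡[a∸m]+mp = subst (λ b → q * b ≡ (a ∸ m) + m * suc (b * 2)) (m+[n∸m]≡n (<⇒≤ m<a))
    (solve 2 (λ m d → (con 1 :+ m :* con 2) :* (m :+ d) := d :+ m :* (con 1 :+ (m :+ d) :* con 2))
       refl m (a ∸ m))
  qa/p≡m : q * a / p ≡ m
  qa/p≡m = begin
    q * a / p                    ≡⟨ /-congˡ qa≡[a∸m]+mp ⟩
    ((a ∸ m) + m * p) / p        ≡⟨ +-distrib-/-∣ʳ (a ∸ m) (divides m refl) ⟩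
    (a ∸ m) / p + m * p / p      ≡⟨ cong₂ _+_ (m<n⇒m/n≡0 a∸m<p) (m*n/n≡m m p) ⟩
    m                            ∎
    where
    open ≡-Reasoning
    a∸m<p : a ∸ m < p
    a∸m<p = s≤s (≤-trans (m∸n≤m a m) (m≤m*n a 2))
  pm≤qa : p * m ≤ q * a
  pm≤qa = ≤-trans (≤-reflexive (*-comm p m)) (subst (m * p ≤_) (sym qa≡[a∸m]+mp) (m≤n+m (m * p) (a ∸ m)))
  solutions : Solutions p q (q * a) ↔ Fin N
  solutions = subst (λ b → Solutions p q (q * a) ↔ Fin (sumBelow (λ x → suc ((q * a ∸ p * x) / q)) (suc b)))
    qa/p≡m (Solutions↔Fin p q (q * a))
  half[q*[p∸1]] : q * (p ∸ 1) / 2 ≡ q * a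
  half[q*[p∸1]] = trans (/-congˡ (sym (*-assoc q a 2))) (m*n/n≡m (q * a) 2)
  half[p+1] : (p + 1) / 2 ≡ suc a
  half[p+1] = trans (/-congˡ {o = 2} (+-comm p 1)) (m*n/n≡m (suc a) 2)
  quarter[[p∸1]*[q∸1]] : (p ∸ 1) * (q ∸ 1) / 4 ≡ a * m
  quarter[[p∸1]*[q∸1]] = trans
    (/-congˡ (solve 2 (λ a m → (a :* con 2) :* (m :* con 2) := (a :* m) :* con 4) refl a m))
    (m*n/n≡m (a * m) 4)
  ℤ-count : + N ≡ (+ ((p + 1) / 2) Data.Integer.+ + (((p ∸ 1) * (q ∸ 1)) / 4)) - + floorSum p q ((q ∸ 1) / 2)
  ℤ-count = trans (m+n≡o+p⇒+m≡+o++p-+n {o = suc a} {p = a * m} (sumBelow-fibres+floorSum p q a m pm≤qa q∤xp))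
    (sym (cong₂ _-_ (cong₂ Data.Integer._+_ (cong +_ half[p+1]) (cong +_ quarter[[p∸1]*[q∸1]]))
                    (cong (λ b → + floorSum p q b) (m*n/n≡m m 2))))

odd⇒≡1+[n/2]*2 : ∀ {n} → n % 2 ≡ 1 → n ≡ suc (n / 2 * 2)
odd⇒≡1+[n/2]*2 {n} n%2≡1 = trans (m≡m%n+[m/n]*n n 2) (cong (_+ n / 2 * 2) n%2≡1)

prime∤⇒∤* : ∀ {q} x y → Prime q → q ∤ x → q ∤ y → q ∤ x * y
prime∤⇒∤* x y q-prime q∤x q∤y q∣xy = [ q∤x , q∤y ]′ (euclidsLemma x y q-prime q∣xy)

prime<prime⇒∤ : ∀ {p q} → Prime p → Prime q → q < p → q ∤ p
prime<prime⇒∤ p-prime q-prime q<p q∣p =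
  [ (λ q≡1 → ¬prime[1] (subst Prime q≡1 q-prime)) , (λ q≡p → <-irrefl q≡p q<p) ]′
  (prime⇒irreducible p-prime q∣p)

lemma10 : (p q : ℕ) → Prime p → Prime q → p % 2 ≡ 1 → q % 2 ≡ 1 → q < p →
    .{{_ : NonZero q}} →
    Σ ℕ λ N → (Solutions p q ((q * (p ∸ 1)) / 2) ↔ Fin N)
      × (+ N ≡ (+ ((p + 1) / 2) Data.Integer.+ + (((p ∸ 1) * (q ∸ 1)) / 4)) - + floorSum p q ((q ∸ 1) / 2))
lemma10 p q p-prime q-prime p-odd q-odd q<p =
  solutionCount-odd p q (p / 2) (q / 2) (odd⇒≡1+[n/2]*2 p-odd) (odd⇒≡1+[n/2]*2 q-odd) q/2<p/2 q∤xp
  where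
  q/2<p/2 : q / 2 < p / 2
  q/2<p/2 = *-cancelʳ-< 2 (q / 2) (p / 2)
    (s≤s⁻¹ (subst₂ _<_ (odd⇒≡1+[n/2]*2 q-odd) (odd⇒≡1+[n/2]*2 p-odd) q<p))
  q∤xp : ∀ x → 0 < x → x ≤ q / 2 → q ∤ x * p
  q∤xp x@(suc _) _ x≤q/2 = prime∤⇒∤* x p q-prime
    (>⇒∤ (≤-<-trans x≤q/2 (m/n<m q 2 (s<s z<s))))
    (prime<prime⇒∤ p-prime q-prime q<p)
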